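{- For each positive integer $n$ let $G_n$ be a bipartite graph whose two vertex classes are both copies of $[n]=\{1,\dots,n\}$. Assume that for every $\varepsilon>0$ there exist an integer $n(\varepsilon)$ and a number $c(\varepsilon)>0$ such that $e_{G_n}(A,A)\ge c(\varepsilon)|A|^2\bar d(G_n)/n$ for all $n\ge n(\varepsilon)$ and all $A\subseteq[n]$ with $|A|\ge \varepsilon n$. Then for every $\alpha>0$ there exist an integer $n(\alpha)$ and a number $C(\alpha)>0$ such that the following holds: if $n\ge n(\alpha)$, $s$ is an integer with $C(\alpha)n/\bar d(G_n)\le s\le n$, and $S$ is a subset of $[n]$ chosen uniformly at random among all subsets of cardinality $s$, then the probability that $G_n(S,S)$ is empty (has no edges) is at most $\alpha^s$.
   Context: For a bipartite graph $G$ with vertex classes $V_1=[n]$ and $V_2=[n]$ (two copies of $[n]$) and subsets $X,Y\subseteq[n]$, $e_G(X,Y)$ denotes the number of edges $(u,v)$ of $G$ with $u\in X$ taken in the first class $V_1$ and $v\in Y$ taken in the second class $V_2$, and $G(X,Y)$ denotes the bipartite subgraph induced on $X\subseteq V_1$ and $Y\subseteq V_2$. The average degree of $G$ is $\bar d(G)=e_G([n],[n])/n$.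
   Formalization: The parameters ε and α range over the positive rationals, and the constants c(ε) and C(α) are taken in the rationals. -}

module Defs where

open import Data.Nat as ℕ using (ℕ; zero; suc; _+_)
open import Data.Nat.Combinatorics using (_C_)
open import Data.Bool using (Bool; true; false; if_then_else_; _∧_)
open import Data.Fin using (Fin)
open import Data.Fin.Subset using (Subset; ∣_∣; ⊤)
open import Data.Vec using (Vec; []; _∷_; lookup)
open import Data.List using (List; []; _∷_; _++_; map; filterᵇ; length; allFin)
open import Data.Nat.ListAction using (sum)
open import Data.Integer using (+_)
open import Data.Rational using (ℚ; _/_; _*_; 1ℚ)

-- A bipartite graph with both vertex classes equal to [n] (modelled as Fin n):
-- G u v = true iff (u ∈ V₁, v ∈ V₂) is an edge.
BipGraph : ℕ → Set
BipGraph n = Fin n → Fin n → Bool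

eG : {n : ℕ} → BipGraph n → Subset n → Subset n → ℕ
eG {n} G X Y =
  sum (map (λ u → sum (map (λ v → if lookup X u ∧ lookup Y v ∧ G u v then 1 else 0)
                           (allFin n)))
           (allFin n))

ℕ→ℚ : ℕ → ℚ
ℕ→ℚ k = + k / 1

-- average degree  d̄(G) = e_G([n],[n]) / n   (convention: 0 for n = 0)
avgDeg : {n : ℕ} → BipGraph n → ℚ
avgDeg {zero}  G = ℕ→ℚ 0
avgDeg {suc m} G = + eG G ⊤ ⊤ / suc m

_^ℚ_ : ℚ → ℕ → ℚ
q ^ℚ zero  = 1ℚ
q ^ℚ suc k = q * (q ^ℚ k)

allSubsets : (n : ℕ) → List (Subset n)
allSubsets zero    = [] ∷ []
allSubsets (suc n) = map (true ∷_) (allSubsets n) ++ map (false ∷_) (allSubsets n)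

hasSize : {n : ℕ} → ℕ → Subset n → Bool
hasSize s S = ∣ S ∣ ℕ.≡ᵇ s

isEmptyInduced : {n : ℕ} → BipGraph n → Subset n → Bool
isEmptyInduced G S = eG G S S ℕ.≡ᵇ 0

countEmpty : {n : ℕ} → BipGraph n → ℕ → ℕ
countEmpty {n} G s =
  length (filterᵇ (λ S → hasSize s S ∧ isEmptyInduced G S) (allSubsets n))

-- Probability that G(S,S) is empty for S uniform among the (n choose s)
-- subsets of [n] of size s (convention: 0 if there are no such subsets).
probEmpty : {n : ℕ} → BipGraph n → ℕ → ℚ
probEmpty {n} G s with n C s
... | zero  = ℕ→ℚ 0
... | suc k = + countEmpty G s / suc k

-- Kleitman–Winston container argument. Fix a degree threshold t. As long as the current
-- vertex set A is larger than b = n / (8q²), the density hypothesis provides a vertex u ∈ A with at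
-- least t closed out-neighbours inside A (for t ≈ e(G) / (8q² p n)); an independent set either avoids u,
-- or contains u and avoids its neighbourhood, so A shrinks by one or by t. Hence the number of
-- independent s-sets is at most Σ_{j ≤ n/t} C(n,j) C(b,s−j). The lower bound on s makes n/t ≤ s/2,
-- so each term is at most C(n,s) C(s,j) (4q²)^{−(s−j)} ≤ C(n,s) C(s,j) (2q)^{−s}, and the sum is
-- at most C(n,s) q^{−s}: G(S,S) is empty with probability at most q^{−s} ≤ α^s when α ≥ 1/q.

module Submission where

open import Defs
open import Data.Bool using (Bool; true; false; T; not; _∧_; _∨_; if_then_else_)
open import Data.Bool.Properties using (T-∧; T-∨)
open import Data.Empty using (⊥-elim)
open import Data.Fin using (Fin; zero; suc; toℕ; _≟_)
open import Data.Fin.Properties using (any?; toℕ<n)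
open import Data.Fin.Subset using (Subset; ∣_∣; ⊤)
open import Data.Integer as ℤ using (+[1+_]; -[1+_]; +≤+)
import Data.Integer.Properties as ℤ
open import Data.List as List using ([]; _∷_; _++_; filterᵇ; length; allFin)
open import Data.List.Properties using (filter-++; length-++; map-tabulate)
open import Data.Nat as ℕ using (ℕ; zero; suc; _+_; _*_; _∸_; _^_; _!; _≤_; _<_; z≤n; s≤s; s≤s⁻¹; NonZero)
open import Data.Nat.Combinatorics using (_C_; nCk+nC[k+1]≡[n+1]C[k+1]; nCk≡n!/k![n-k]!; k![n∸k]!∣n!; k>n⇒nCk≡0)
open import Data.Nat.Combinatorics.Base using (_P′_)
open import Data.Nat.Combinatorics.Specification using (nP′k≡n!/[n∸k]!)
open import Data.Nat.Divisibility using (m≤n⇒m!∣n!)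
open import Data.Nat.DivMod
  using (_/_; /-monoˡ-≤; [m∸n]/n≡m/n∸1; m≥n⇒m/n>0; m/n*n≡m; m/n*n≤m; m*n/n≡m; m≡m%n+[m/n]*n; m%n<n)
open import Data.Nat.Induction using (<-rec)
import Data.Nat.ListAction as ListAction
open import Data.Nat.Properties hiding (_≟_)
open import Algebra.Properties.CommutativeSemigroup +-commutativeSemigroup using (interchange; x∙yz≈y∙xz)
open import Algebra.Properties.Semiring.Sum +-*-semiring
  using (sum; sum-syntax; sum-cong-≗; sum-replicate-zero; ∑-distrib-+; *-distribˡ-sum; *-distribʳ-sum)
open import Data.Nat.Tactic.RingSolver using (solve-∀)
open import Data.Product using (Σ; _×_; _,_; proj₁; proj₂)
open import Data.Rational as ℚ using (ℚ; mkℚ; 0ℚ; toℚᵘ)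
import Data.Rational.Properties as ℚ
import Data.Rational.Unnormalised as ℚᵘ
import Data.Rational.Unnormalised.Properties as ℚᵘ
open import Data.Sum using (_⊎_; inj₁; inj₂; [_,_])
open import Data.Unit using (tt)
open import Data.Vec using (_∷_; []; lookup; tabulate; _[_]≔_)
open import Data.Vec.Properties using (lookup∘update; lookup∘update′; lookup∘tabulate)
open import Function using (_∘_; id; it; case_of_; Equivalence)
open import Relation.Binary.PropositionalEquality
  using (_≡_; refl; sym; trans; cong; cong₂; subst; subst₂; module ≡-Reasoning)
open import Relation.Nullary using (¬_; yes; no; does; contradiction)
open import Relation.Nullary.Decidable using (T?; _×-dec_)

open Equivalence using (to; from)

∑-mono-≤ : ∀ {n} {f g : Fin n → ℕ} → (∀ i → f i ≤ g i) → sum f ≤ sum g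
∑-mono-≤ {zero}  f≤g = z≤n
∑-mono-≤ {suc n} f≤g = +-mono-≤ (f≤g zero) (∑-mono-≤ (f≤g ∘ suc))

term≤∑ : ∀ {n} (f : Fin n → ℕ) i → f i ≤ sum f
term≤∑ f zero    = m≤m+n _ _
term≤∑ f (suc i) = ≤-trans (term≤∑ (f ∘ suc) i) (m≤n+m _ _)

∑-zero : ∀ {n} {f : Fin n → ℕ} → (∀ i → f i ≡ 0) → sum f ≡ 0
∑-zero {n} f≡0 = trans (sum-cong-≗ f≡0) (sum-replicate-zero n)

sum-map-allFin : ∀ {n} (f : Fin n → ℕ) → ListAction.sum (List.map f (allFin n)) ≡ sum f
sum-map-allFin f = trans (cong ListAction.sum (map-tabulate id f)) (sum-tabulate f)
  where
  sum-tabulate : ∀ {n} (f : Fin n → ℕ) → ListAction.sum (List.tabulate f) ≡ sum f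
  sum-tabulate {zero}  f = refl
  sum-tabulate {suc n} f = cong (f zero +_) (sum-tabulate (f ∘ suc))

∑-toℕ-mono-≤ : ∀ {K L} (h : ℕ → ℕ) → K ≤ L → ∑[ j < K ] h (toℕ j) ≤ ∑[ j < L ] h (toℕ j)
∑-toℕ-mono-≤ h z≤n       = z≤n
∑-toℕ-mono-≤ h (s≤s K≤L) = +-monoʳ-≤ (h 0) (∑-toℕ-mono-≤ (h ∘ suc) K≤L)

∑-binomial≤2^ : ∀ s L → ∑[ j < L ] (s C toℕ j) ≤ 2 ^ s
∑-binomial≤2^ zero    zero    = z≤n
∑-binomial≤2^ zero    (suc L) = ≤-reflexive (cong suc (∑-zero {L} (λ _ → refl)))
∑-binomial≤2^ (suc s) zero    = z≤n
∑-binomial≤2^ (suc s) (suc L) = begin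
  1 + ∑[ j < L ] (suc s C suc (toℕ j))
    ≡⟨ cong suc (sum-cong-≗ {L} (λ j → sym (nCk+nC[k+1]≡[n+1]C[k+1] s (toℕ j)))) ⟩
  1 + ∑[ j < L ] (s C toℕ j + s C suc (toℕ j))
    ≡⟨ cong suc (∑-distrib-+ {L} (λ j → s C toℕ j) (λ j → s C suc (toℕ j))) ⟩
  1 + (∑[ j < L ] (s C toℕ j) + ∑[ j < L ] (s C suc (toℕ j)))
    ≡⟨ sym (+-suc _ _) ⟩
  ∑[ j < L ] (s C toℕ j) + ∑[ j < suc L ] (s C toℕ j)
    ≤⟨ +-mono-≤ (∑-binomial≤2^ s L) (∑-binomial≤2^ s (suc L)) ⟩
  2 ^ s + 2 ^ s
    ≡⟨ cong (2 ^ s +_) (sym (+-identityʳ (2 ^ s))) ⟩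
  2 ^ suc s ∎
  where open ≤-Reasoning

ind : Bool → ℕ
ind b = if b then 1 else 0

ind-mono : ∀ {a b} → (T a → T b) → ind a ≤ ind b
ind-mono {false}         _   = z≤n
ind-mono {true}  {true}  _   = ≤-refl
ind-mono {true}  {false} a⇒b = contradiction tt a⇒b

T-not⇒¬T : ∀ {b} → T (not b) → ¬ T b
T-not⇒¬T {true} () _

¬T⇒T-not : ∀ {b} → ¬ T b → T (not b)
¬T⇒T-not {false} _  = tt
¬T⇒T-not {true}  ¬b = ¬b tt

countSubsets : ∀ {n} → (Subset n → Bool) → ℕ
countSubsets {zero}  P = ind (P [])
countSubsets {suc n} P = countSubsets (P ∘ (true ∷_)) + countSubsets (P ∘ (false ∷_))

length-filter-allSubsets : ∀ n (P : Subset n → Bool) → length (filterᵇ P (allSubsets n)) ≡ countSubsets P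
length-filter-allSubsets zero P with P []
... | true  = refl
... | false = refl
length-filter-allSubsets (suc n) P = begin
  length (filterᵇ P (List.map (true ∷_) Ss ++ List.map (false ∷_) Ss))
    ≡⟨ cong length (filter-++ (T? ∘ P) (List.map (true ∷_) Ss) _) ⟩
  length (filterᵇ P (List.map (true ∷_) Ss) ++ filterᵇ P (List.map (false ∷_) Ss))
    ≡⟨ length-++ (filterᵇ P (List.map (true ∷_) Ss)) ⟩
  length (filterᵇ P (List.map (true ∷_) Ss)) + length (filterᵇ P (List.map (false ∷_) Ss))
    ≡⟨ cong₂ _+_ (length-filter-map (true ∷_) Ss) (length-filter-map (false ∷_) Ss) ⟩
  length (filterᵇ (P ∘ (true ∷_)) Ss) + length (filterᵇ (P ∘ (false ∷_)) Ss)
    ≡⟨ cong₂ _+_ (length-filter-allSubsets n _) (length-filter-allSubsets n _) ⟩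
  countSubsets P ∎
  where
  open ≡-Reasoning
  Ss = allSubsets n
  length-filter-map : ∀ {A : Set} (f : A → Subset (suc n)) xs →
                      length (filterᵇ P (List.map f xs)) ≡ length (filterᵇ (P ∘ f) xs)
  length-filter-map f []       = refl
  length-filter-map f (x ∷ xs) with P (f x)
  ... | true  = cong suc (length-filter-map f xs)
  ... | false = length-filter-map f xs

countSubsets-mono : ∀ {n} {P Q : Subset n → Bool} → (∀ S → T (P S) → T (Q S)) →
                    countSubsets P ≤ countSubsets Q
countSubsets-mono {zero}  P⇒Q = ind-mono (P⇒Q [])
countSubsets-mono {suc n} P⇒Q =
  +-mono-≤ (countSubsets-mono (P⇒Q ∘ (true ∷_))) (countSubsets-mono (P⇒Q ∘ (false ∷_)))

countSubsets-none : ∀ {n} {P : Subset n → Bool} → (∀ S → ¬ T (P S)) → countSubsets P ≡ 0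
countSubsets-none {zero} {P} ¬P with P [] | ¬P []
... | false | _   = refl
... | true  | ¬tt = contradiction tt ¬tt
countSubsets-none {suc n} ¬P =
  cong₂ _+_ (countSubsets-none (¬P ∘ (true ∷_))) (countSubsets-none (¬P ∘ (false ∷_)))

-- A subset containing u is counted through S ∖ {u}, which avoids u.
countSubsets-split : ∀ {n} (u : Fin n) (P : Subset n → Bool) →
  countSubsets P ≡ countSubsets (λ S → not (lookup S u) ∧ P (S [ u ]≔ true))
                 + countSubsets (λ S → not (lookup S u) ∧ P S)
countSubsets-split {suc n} zero P = sym (cong₂ _+_
  (cong (_+ countSubsets (P ∘ (true ∷_)))  (countSubsets-none {n} {λ _ → false} λ _ ()))
  (cong (_+ countSubsets (P ∘ (false ∷_))) (countSubsets-none {n} {λ _ → false} λ _ ())))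
countSubsets-split (suc u) P =
  trans (cong₂ _+_ (countSubsets-split u (P ∘ (true ∷_))) (countSubsets-split u (P ∘ (false ∷_))))
        (interchange (count⁺ (P ∘ (true ∷_))) (count⁻ (P ∘ (true ∷_)))
                     (count⁺ (P ∘ (false ∷_))) (count⁻ (P ∘ (false ∷_))))
  where
  count⁺ count⁻ : (Subset _ → Bool) → ℕ
  count⁺ Q = countSubsets (λ S → not (lookup S u) ∧ Q (S [ u ]≔ true))
  count⁻ Q = countSubsets (λ S → not (lookup S u) ∧ Q S)

size : ∀ {n} → (Fin n → Bool) → ℕ
size A = ∑[ v < _ ] ind (A v)

∣∣≡size-lookup : ∀ {n} (S : Subset n) → ∣ S ∣ ≡ size (lookup S)
∣∣≡size-lookup []          = refl
∣∣≡size-lookup (true  ∷ S) = cong suc (∣∣≡size-lookup S)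
∣∣≡size-lookup (false ∷ S) = ∣∣≡size-lookup S

size-mono : ∀ {n} {A B : Fin n → Bool} → (∀ v → T (A v) → T (B v)) → size A ≤ size B
size-mono A⇒B = ∑-mono-≤ (λ v → ind-mono (A⇒B v))

member⇒1≤size : ∀ {n} {A : Fin n → Bool} {u} → T (A u) → 1 ≤ size A
member⇒1≤size {A = A} {u} Au = ≤-trans (ind-mono {true} (λ _ → Au)) (term≤∑ (ind ∘ A) u)

infixl 8 _∩_
infixl 8 _∖_

_∩_ _∖_ : ∀ {n} → (Fin n → Bool) → (Fin n → Bool) → (Fin n → Bool)
(A ∩ B) v = A v ∧ B v
(A ∖ B) v = A v ∧ not (B v)

∖-antitoneʳ : ∀ {n} (A : Fin n → Bool) {B C} → (∀ v → T (B v) → T (C v)) →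
              ∀ v → T ((A ∖ C) v) → T ((A ∖ B) v)
∖-antitoneʳ A B⊆C v A∖Cv with to (T-∧ {A v}) A∖Cv
... | Av , ¬Cv = from T-∧ (Av , ¬T⇒T-not (T-not⇒¬T ¬Cv ∘ B⊆C v))

size-split : ∀ {n} (A B : Fin n → Bool) → size A ≡ size (A ∖ B) + size (A ∩ B)
size-split {n} A B = trans (sum-cong-≗ {n} (λ v → ind-split (A v) (B v))) (∑-distrib-+ {n} _ _)
  where
  ind-split : ∀ a b → ind a ≡ ind (a ∧ not b) + ind (a ∧ b)
  ind-split false b     = refl
  ind-split true  false = refl
  ind-split true  true  = refl

size-∖≤∸ : ∀ {n} (A B : Fin n → Bool) {a t} → t ≤ size (A ∩ B) → size A ≤ a → size (A ∖ B) ≤ a ∸ t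
size-∖≤∸ A B {t = t} t≤A∩B A≤a = m+n≤o⇒m≤o∸n (size (A ∖ B))
  (≤-trans (+-monoʳ-≤ (size (A ∖ B)) t≤A∩B) (≤-trans (≤-reflexive (sym (size-split A B))) A≤a))

⁅_⁆ : ∀ {n} → Fin n → (Fin n → Bool)
⁅ u ⁆ v = does (u ≟ v)

u∈⁅u⁆ : ∀ {n} (u : Fin n) → T (⁅ u ⁆ u)
u∈⁅u⁆ u with u ≟ u
... | yes _   = tt
... | no  u≢u = u≢u refl

∈⁅u⁆⇒≡ : ∀ {n} {u v : Fin n} → T (⁅ u ⁆ v) → u ≡ v
∈⁅u⁆⇒≡ {u = u} {v} u∈v with u ≟ v
... | yes u≡v = u≡v

size-∖⁅⁆ : ∀ {n} {A : Fin n → Bool} {u a} → T (A u) → size A ≤ suc a → size (A ∖ ⁅ u ⁆) ≤ a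
size-∖⁅⁆ {A = A} {u} Au = size-∖≤∸ A ⁅ u ⁆ (member⇒1≤size {A = A ∩ ⁅ u ⁆} (from T-∧ (Au , u∈⁅u⁆ u)))

infix 7 _⊆ᵇ_

_⊆ᵇ_ : ∀ {n} → Subset n → (Fin n → Bool) → Bool
[]      ⊆ᵇ A = true
(x ∷ S) ⊆ᵇ A = (not x ∨ A zero) ∧ (S ⊆ᵇ A ∘ suc)

⊆ᵇ⇒⊆ : ∀ {n} (S : Subset n) A → T (S ⊆ᵇ A) → ∀ v → T (lookup S v) → T (A v)
⊆ᵇ⇒⊆ (true ∷ S) A S⊆A zero    _  = proj₁ (to T-∧ S⊆A)
⊆ᵇ⇒⊆ (x    ∷ S) A S⊆A (suc v) Sv = ⊆ᵇ⇒⊆ S (A ∘ suc) (proj₂ (to (T-∧ {not x ∨ A zero}) S⊆A)) v Sv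

⊆⇒⊆ᵇ : ∀ {n} (S : Subset n) A → (∀ v → T (lookup S v) → T (A v)) → T (S ⊆ᵇ A)
⊆⇒⊆ᵇ []          A S⊆A = tt
⊆⇒⊆ᵇ (true  ∷ S) A S⊆A = from T-∧ (S⊆A zero tt , ⊆⇒⊆ᵇ S (A ∘ suc) (S⊆A ∘ suc))
⊆⇒⊆ᵇ (false ∷ S) A S⊆A = ⊆⇒⊆ᵇ S (A ∘ suc) (S⊆A ∘ suc)

lookup-insert-⊇ : ∀ {n} (S : Subset n) u {v} → T (lookup S v) → T (lookup (S [ u ]≔ true) v)
lookup-insert-⊇ S u {v} Sv with u ≟ v
... | yes refl = subst T (sym (lookup∘update u S true)) tt
... | no  u≢v  = subst T (sym (lookup∘update′ (u≢v ∘ sym) S true)) Sv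

∣insert∣ : ∀ {n} (S : Subset n) u → T (not (lookup S u)) → ∣ S [ u ]≔ true ∣ ≡ suc ∣ S ∣
∣insert∣ (false ∷ S) zero    _   = refl
∣insert∣ (true  ∷ S) (suc u) u∉S = cong suc (∣insert∣ S u u∉S)
∣insert∣ (false ∷ S) (suc u) u∉S = ∣insert∣ S u u∉S

eG≡∑∑ : ∀ {n} (G : BipGraph n) X Y →
        eG G X Y ≡ ∑[ u < n ] ∑[ v < n ] ind (lookup X u ∧ lookup Y v ∧ G u v)
eG≡∑∑ {n} G X Y = trans (sum-map-allFin {n} _) (sum-cong-≗ {n} (λ u → sum-map-allFin {n} _))

isEmptyInduced-antitone : ∀ {n} (G : BipGraph n) {S S′ : Subset n} →
  (∀ v → T (lookup S v) → T (lookup S′ v)) → T (isEmptyInduced G S′) → T (isEmptyInduced G S)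
isEmptyInduced-antitone {n} G {S} {S′} S⊆S′ empty′ = ≡⇒≡ᵇ _ 0 (n≤0⇒n≡0 (begin
  eG G S S      ≡⟨ eG≡∑∑ G S S ⟩
  ∑[ u < n ] ∑[ v < n ] ind (lookup S u ∧ lookup S v ∧ G u v)
                ≤⟨ ∑-mono-≤ (λ u → ∑-mono-≤ (λ v → ind-mono (edge-mono u v))) ⟩
  ∑[ u < n ] ∑[ v < n ] ind (lookup S′ u ∧ lookup S′ v ∧ G u v)
                ≡⟨ sym (eG≡∑∑ G S′ S′) ⟩
  eG G S′ S′    ≡⟨ ≡ᵇ⇒≡ _ 0 empty′ ⟩
  0 ∎))
  where
  open ≤-Reasoning
  edge-mono : ∀ u v → T (lookup S u ∧ lookup S v ∧ G u v) → T (lookup S′ u ∧ lookup S′ v ∧ G u v)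
  edge-mono u v e with to (T-∧ {lookup S u}) e
  ... | Su , e′ with to (T-∧ {lookup S v}) e′
  ... | Sv , Guv = from T-∧ (S⊆S′ u Su , from T-∧ (S⊆S′ v Sv , Guv))

isEmptyInduced⇒¬edge : ∀ {n} (G : BipGraph n) {S : Subset n} {u v} →
  T (isEmptyInduced G S) → T (lookup S u) → T (lookup S v) → ¬ T (G u v)
isEmptyInduced⇒¬edge {n} G {S} {u} {v} empty Su Sv Guv = 1≰0 (begin
  1             ≤⟨ ind-mono {true} (λ _ → from T-∧ (Su , from T-∧ (Sv , Guv))) ⟩
  edges u v     ≤⟨ term≤∑ (edges u) v ⟩
  sum (edges u) ≤⟨ term≤∑ (sum ∘ edges) u ⟩
  ∑[ u < n ] sum (edges u) ≡⟨ sym (eG≡∑∑ G S S) ⟩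
  eG G S S      ≡⟨ ≡ᵇ⇒≡ _ 0 empty ⟩
  0 ∎)
  where
  open ≤-Reasoning
  edges : Fin n → Fin n → ℕ
  edges u v = ind (lookup S u ∧ lookup S v ∧ G u v)
  1≰0 : ¬ 1 ≤ 0
  1≰0 ()

closedNbhd : ∀ {n} → BipGraph n → Fin n → (Fin n → Bool)
closedNbhd G u v = ⁅ u ⁆ v ∨ G u v

⁅u⁆⊆closedNbhd : ∀ {n} (G : BipGraph n) u v → T (⁅ u ⁆ v) → T (closedNbhd G u v)
⁅u⁆⊆closedNbhd G u v u≡v = from T-∨ (inj₁ u≡v)

independentSubsets : ∀ {n} → BipGraph n → (Fin n → Bool) → ℕ → ℕ
independentSubsets G A r = countSubsets (λ S → S ⊆ᵇ A ∧ (hasSize r S ∧ isEmptyInduced G S))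

-- An independent (r+1)-set either avoids u, or contains u and then the rest avoids all out-neighbours of u.
independentSubsets-split : ∀ {n} (G : BipGraph n) A u r →
  independentSubsets G A (suc r) ≤
  independentSubsets G (A ∖ closedNbhd G u) r + independentSubsets G (A ∖ ⁅ u ⁆) (suc r)
independentSubsets-split G A u r = begin
  independentSubsets G A (suc r)
    ≡⟨ countSubsets-split u P ⟩
  countSubsets (λ S → not (lookup S u) ∧ P (S [ u ]≔ true)) + countSubsets (λ S → not (lookup S u) ∧ P S)
    ≤⟨ +-mono-≤ (countSubsets-mono containing) (countSubsets-mono avoiding) ⟩
  independentSubsets G (A ∖ closedNbhd G u) r + independentSubsets G (A ∖ ⁅ u ⁆) (suc r) ∎
  where
  open ≤-Reasoning
  P = λ S → S ⊆ᵇ A ∧ (hasSize (suc r) S ∧ isEmptyInduced G S)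
  u∉⁅v⁆ : ∀ {S v} → T (not (lookup S u)) → T (lookup S v) → ¬ T (⁅ u ⁆ v)
  u∉⁅v⁆ {S} u∉S Sv u≡v = T-not⇒¬T u∉S (subst (T ∘ lookup S) (sym (∈⁅u⁆⇒≡ u≡v)) Sv)
  containing : ∀ S → T (not (lookup S u) ∧ P (S [ u ]≔ true)) →
               T (S ⊆ᵇ A ∖ closedNbhd G u ∧ (hasSize r S ∧ isEmptyInduced G S))
  containing S h with to (T-∧ {not (lookup S u)}) h
  ... | u∉S , PS′ with to (T-∧ {(S [ u ]≔ true) ⊆ᵇ A}) PS′
  ... | S′⊆A , rest with to (T-∧ {hasSize (suc r) (S [ u ]≔ true)}) rest
  ... | size′ , empty′ = from T-∧ (⊆⇒⊆ᵇ S _ S⊆A∖N , from T-∧ (sizeS , emptyS))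
    where
    S′ = S [ u ]≔ true
    S⊆A∖N : ∀ v → T (lookup S v) → T ((A ∖ closedNbhd G u) v)
    S⊆A∖N v Sv = from T-∧ (⊆ᵇ⇒⊆ S′ A S′⊆A v (lookup-insert-⊇ S u Sv) , ¬T⇒T-not (λ h →
      [ u∉⁅v⁆ {S} u∉S Sv
               , isEmptyInduced⇒¬edge G {S′} empty′ (subst T (sym (lookup∘update u S true)) tt)
                                                (lookup-insert-⊇ S u Sv) ] (to T-∨ h)))
    sizeS : T (hasSize r S)
    sizeS = ≡⇒≡ᵇ ∣ S ∣ r (suc-injective (trans (sym (∣insert∣ S u u∉S)) (≡ᵇ⇒≡ ∣ S′ ∣ (suc r) size′)))
    emptyS : T (isEmptyInduced G S)
    emptyS = isEmptyInduced-antitone G {S} {S′} (λ v → lookup-insert-⊇ S u) empty′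
  avoiding : ∀ S → T (not (lookup S u) ∧ P S) →
             T (S ⊆ᵇ A ∖ ⁅ u ⁆ ∧ (hasSize (suc r) S ∧ isEmptyInduced G S))
  avoiding S h with to (T-∧ {not (lookup S u)}) h
  ... | u∉S , PS with to (T-∧ {S ⊆ᵇ A}) PS
  ... | S⊆A , rest = from T-∧ (⊆⇒⊆ᵇ S _ (λ v Sv → from T-∧ (⊆ᵇ⇒⊆ S A S⊆A v Sv , ¬T⇒T-not (u∉⁅v⁆ {S} u∉S Sv))) , rest)

independentSubsets-zero : ∀ {n} (G : BipGraph n) A → independentSubsets G A 0 ≤ 1
independentSubsets-zero {n} G A =
  ≤-trans (countSubsets-mono (λ S h → proj₁ (to (T-∧ {hasSize 0 S}) (proj₂ (to (T-∧ {S ⊆ᵇ A}) h)))))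
          (≤-reflexive (count-size0 n))
  where
  count-size0 : ∀ n → countSubsets {n} (λ S → ∣ S ∣ ℕ.≡ᵇ 0) ≡ 1
  count-size0 zero    = refl
  count-size0 (suc n) = cong₂ _+_ (countSubsets-none {n} {λ _ → false} λ _ ()) (count-size0 n)

independentSubsets-∅ : ∀ {n} (G : BipGraph n) {A} → (∀ v → ¬ T (A v)) → ∀ r → independentSubsets G A (suc r) ≡ 0
independentSubsets-∅ {n} G {A} ∉A r = countSubsets-none λ S h →
  let S⊆A , rest = to (T-∧ {S ⊆ᵇ A}) h
      ∣S∣≡1+r    = ≡ᵇ⇒≡ ∣ S ∣ (suc r) (proj₁ (to (T-∧ {hasSize (suc r) S}) rest))
      ∣S∣≤0      = begin
        ∣ S ∣              ≡⟨ ∣∣≡size-lookup S ⟩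
        size (lookup S)    ≤⟨ size-mono (λ v Sv → ∉A v (⊆ᵇ⇒⊆ S A S⊆A v Sv)) ⟩
        size {n} (λ _ → false) ≡⟨ ∑-zero {n} (λ _ → refl) ⟩
        0 ∎
  in  contradiction (subst (_≤ 0) ∣S∣≡1+r ∣S∣≤0) λ ()
  where open ≤-Reasoning

C-suc : ∀ a r → a C r ≤ suc a C r
C-suc a zero    = ≤-refl
C-suc a (suc r) = ≤-trans (m≤n+m _ _) (≤-reflexive (nCk+nC[k+1]≡[n+1]C[k+1] a r))

C-monoˡ-≤ : ∀ {a b} r → a ≤ b → a C r ≤ b C r
C-monoˡ-≤ r a≤b = go (≤⇒≤′ a≤b)
  where
  go : ∀ {a b} → a ℕ.≤′ b → a C r ≤ b C r
  go ℕ.≤′-refl        = ≤-refl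
  go (ℕ.≤′-step a≤′b) = ≤-trans (go a≤′b) (C-suc _ r)

independentSubsets≤C : ∀ {n} (G : BipGraph n) a A r → size A ≤ a → independentSubsets G A r ≤ a C r
independentSubsets≤C G a A zero _ = independentSubsets-zero G A
independentSubsets≤C G a A (suc r) A≤a with any? (λ v → T? (A v))
... | no ∄u = ≤-trans (≤-reflexive (independentSubsets-∅ G (λ v Av → ∄u (v , Av)) r)) z≤n
... | yes (u , Au) with a
...   | zero   = contradiction (≤-trans (member⇒1≤size {A = A} Au) A≤a) λ ()
...   | suc a′ = begin
  independentSubsets G A (suc r)
    ≤⟨ independentSubsets-split G A u r ⟩
  independentSubsets G (A ∖ closedNbhd G u) r + independentSubsets G (A ∖ ⁅ u ⁆) (suc r)
    ≤⟨ +-mono-≤ (independentSubsets≤C G a′ _ r (≤-trans (size-mono (∖-antitoneʳ A (⁅u⁆⊆closedNbhd G u))) A∖u≤a′))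
                (independentSubsets≤C G a′ _ (suc r) A∖u≤a′) ⟩
  a′ C r + a′ C suc r
    ≡⟨ nCk+nC[k+1]≡[n+1]C[k+1] a′ r ⟩
  suc a′ C suc r ∎
  where
  open ≤-Reasoning
  A∖u≤a′ = size-∖⁅⁆ {A = A} Au A≤a

-- The container bound

-- b C (r ∸ j), except that it vanishes for j > r, where truncated subtraction would give b C 0 = 1.
restChoices : ℕ → ℕ → ℕ → ℕ
restChoices b r       zero    = b C r
restChoices b zero    (suc j) = 0
restChoices b (suc r) (suc j) = restChoices b r j

-- At most a / t high-degree vertices are chosen (C(a,j) ways for j of them); the other r ∸ j
-- vertices lie in the final container, of size at most b.
kwBound : ∀ (b t : ℕ) .{{_ : NonZero t}} → ℕ → ℕ → ℕ
kwBound b t a r = ∑[ j < suc (a / t) ] ((a C toℕ j) * restChoices b r (toℕ j))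

kwBound-head : ∀ b t .{{_ : NonZero t}} a r → b C r ≤ kwBound b t a r
kwBound-head b t a r = ≤-trans (≤-reflexive (sym (*-identityˡ (b C r))))
  (m≤m+n (1 * (b C r)) (∑[ j < a / t ] ((a C suc (toℕ j)) * restChoices b r (suc (toℕ j)))))

kwBound-step : ∀ b t .{{_ : NonZero t}} a r → t ≤ suc a →
  kwBound b t (suc a ∸ t) r + kwBound b t a (suc r) ≤ kwBound b t (suc a) (suc r)
kwBound-step b t a r t≤1+a = begin
  kwBound b t (suc a ∸ t) r + kwBound b t a (suc r)
    ≤⟨ +-mono-≤ (≤-trans (≤-reflexive (cong (λ L → ∑[ j < L ] (((suc a ∸ t) C toℕ j) * R (toℕ j))) steps))
                         (∑-mono-≤ {K} (λ j → *-monoˡ-≤ (R (toℕ j)) (C-monoˡ-≤ (toℕ j) 1+a∸t≤a))))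
                (+-monoʳ-≤ B (∑-toℕ-mono-≤ (λ j → (a C suc j) * R j) (/-monoˡ-≤ t (n≤1+n a)))) ⟩
  Σ₀ + (B + Σ₁)        ≡⟨ x∙yz≈y∙xz Σ₀ B Σ₁ ⟩
  B + (Σ₀ + Σ₁)        ≡⟨ cong (B +_) (sym (∑-distrib-+ {K} _ _)) ⟩
  B + ∑[ j < K ] ((a C toℕ j) * R (toℕ j) + (a C suc (toℕ j)) * R (toℕ j))
                       ≡⟨ cong (B +_) (sum-cong-≗ {K} λ j → pascal (toℕ j)) ⟩
  kwBound b t (suc a) (suc r) ∎
  where
  open ≤-Reasoning
  K = suc a / t
  R = restChoices b r
  B = 1 * (b C suc r)
  Σ₀ = ∑[ j < K ] ((a C toℕ j) * R (toℕ j))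
  Σ₁ = ∑[ j < K ] ((a C suc (toℕ j)) * R (toℕ j))
  instance
    K≢0 : NonZero K
    K≢0 = ℕ.>-nonZero (m≥n⇒m/n>0 t≤1+a)
  steps : suc ((suc a ∸ t) / t) ≡ K
  steps = trans (cong suc ([m∸n]/n≡m/n∸1 (suc a) t)) (suc-pred K)
  1+a∸t≤a : suc a ∸ t ≤ a
  1+a∸t≤a = ∸-monoʳ-≤ (suc a) (ℕ.>-nonZero⁻¹ t)
  pascal : ∀ j → (a C j) * R j + (a C suc j) * R j ≡ (suc a C suc j) * R j
  pascal j = trans (sym (*-distribʳ-+ (R j) (a C j) (a C suc j))) (cong (_* R j) (nCk+nC[k+1]≡[n+1]C[k+1] a j))

LargeSetsHaveDegree : ∀ {n} → BipGraph n → ℕ → ℕ → Set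
LargeSetsHaveDegree {n} G b t =
  ∀ A → size A ≤ b ⊎ Σ (Fin n) λ u → T (A u) × t ≤ size (A ∩ closedNbhd G u)

containerBound : ∀ {n} (G : BipGraph n) b t .{{_ : NonZero t}} → LargeSetsHaveDegree G b t →
  ∀ a A r → size A ≤ a → independentSubsets G A r ≤ kwBound b t a r
containerBound G b t large-degree = <-rec _ bound
  where
  bound : ∀ a → (∀ {a′} → a′ < a → ∀ A r → size A ≤ a′ → independentSubsets G A r ≤ kwBound b t a′ r) →
          ∀ A r → size A ≤ a → independentSubsets G A r ≤ kwBound b t a r
  bound a _ A zero _ = ≤-trans (independentSubsets-zero G A) (kwBound-head b t a 0)
  bound a rec A (suc r) A≤a with large-degree A
  ... | inj₁ A≤b = ≤-trans (independentSubsets≤C G b A (suc r) A≤b) (kwBound-head b t a (suc r))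
  ... | inj₂ (u , Au , t≤deg) with a
  ...   | zero   = contradiction (≤-trans (member⇒1≤size {A = A} Au) A≤a) λ ()
  ...   | suc a′ = begin
    independentSubsets G A (suc r)
      ≤⟨ independentSubsets-split G A u r ⟩
    independentSubsets G (A ∖ closedNbhd G u) r + independentSubsets G (A ∖ ⁅ u ⁆) (suc r)
      ≤⟨ +-mono-≤ (rec (∸-monoʳ-< (ℕ.>-nonZero⁻¹ t) t≤1+a′) _ r (size-∖≤∸ A (closedNbhd G u) t≤deg A≤a))
                  (rec ≤-refl _ (suc r) (size-∖⁅⁆ {A = A} Au A≤a)) ⟩
    kwBound b t (suc a′ ∸ t) r + kwBound b t a′ (suc r)
      ≤⟨ kwBound-step b t a′ r t≤1+a′ ⟩
    kwBound b t (suc a′) (suc r) ∎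
    where
    open ≤-Reasoning
    t≤1+a′ : t ≤ suc a′
    t≤1+a′ = ≤-trans t≤deg (≤-trans (m≤n+m _ _) (≤-trans (≤-reflexive (sym (size-split A _))) A≤a))

-- Estimating the container bound

nCk*k![n∸k]!≡n! : ∀ {n k} → k ≤ n → (n C k) * (k ! * (n ∸ k) !) ≡ n !
nCk*k![n∸k]!≡n! {n} {k} k≤n = trans (cong (_* (k ! * (n ∸ k) !)) (nCk≡n!/k![n-k]! k≤n))
                                     (m/n*n≡m {{k !* (n ∸ k) !≢0}} (k![n∸k]!∣n! k≤n))

nCk*k!≡nP′k : ∀ {n k} → k ≤ n → (n C k) * k ! ≡ n P′ k
nCk*k!≡nP′k {n} {k} k≤n = *-cancelʳ-≡ _ _ ((n ∸ k) !) {{(n ∸ k) !≢0}} (begin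
  (n C k) * k ! * (n ∸ k) !      ≡⟨ *-assoc (n C k) (k !) ((n ∸ k) !) ⟩
  (n C k) * (k ! * (n ∸ k) !)    ≡⟨ nCk*k![n∸k]!≡n! k≤n ⟩
  n !                            ≡⟨ sym (m/n*n≡m {{(n ∸ k) !≢0}} (m≤n⇒m!∣n! (m∸n≤m n k))) ⟩
  (n ! / (n ∸ k) !) {{(n ∸ k) !≢0}} * (n ∸ k) !
                                 ≡⟨ cong (_* (n ∸ k) !) (sym (nP′k≡n!/[n∸k]! k≤n)) ⟩
  (n P′ k) * (n ∸ k) !           ∎)
  where open ≡-Reasoning

P′-scale : ∀ {x b M} r → 1 ≤ x → x * b ≤ M → (b P′ r) * x ^ r ≤ M P′ r
P′-scale             zero    _   _     = ≤-refl
P′-scale {x} {b} {M} (suc r) 1≤x xb≤M = begin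
  (b ∸ r) * (b P′ r) * (x * x ^ r)   ≡⟨ regroup (b ∸ r) (b P′ r) x (x ^ r) ⟩
  (b ∸ r) * x * ((b P′ r) * x ^ r)   ≤⟨ *-mono-≤ factor (P′-scale r 1≤x xb≤M) ⟩
  (M ∸ r) * (M P′ r)                 ∎
  where
  open ≤-Reasoning
  regroup : ∀ a p y z → a * p * (y * z) ≡ a * y * (p * z)
  regroup = solve-∀
  factor : (b ∸ r) * x ≤ M ∸ r
  factor = ≤-trans (≤-reflexive (*-distribʳ-∸ x b r))
                   (∸-mono (≤-trans (≤-reflexive (*-comm b x)) xb≤M) (m≤m*n r x {{ℕ.>-nonZero 1≤x}}))

C-scale : ∀ {x b M} r → 1 ≤ x → x * b ≤ M → (b C r) * x ^ r ≤ M C r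
C-scale {x} {b} {M} r 1≤x xb≤M with r ℕ.≤? b
... | no  r≰b rewrite k>n⇒nCk≡0 (≰⇒> r≰b) = z≤n
... | yes r≤b = *-cancelʳ-≤ _ _ (r !) {{r !≢0}} (begin
  (b C r) * x ^ r * r !   ≡⟨ swap (b C r) (x ^ r) (r !) ⟩
  (b C r) * r ! * x ^ r   ≡⟨ cong (_* x ^ r) (nCk*k!≡nP′k r≤b) ⟩
  (b P′ r) * x ^ r        ≤⟨ P′-scale r 1≤x xb≤M ⟩
  M P′ r                  ≡⟨ sym (nCk*k!≡nP′k r≤M) ⟩
  (M C r) * r !           ∎)
  where
  open ≤-Reasoning
  swap : ∀ a y z → a * y * z ≡ a * z * y
  swap = solve-∀
  r≤M : r ≤ M
  r≤M = ≤-trans r≤b (≤-trans (m≤n*m b x {{ℕ.>-nonZero 1≤x}}) xb≤M)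

nCj*[n∸j]C[s∸j]≡nCs*sCj : ∀ {n s j} → j ≤ s → s ≤ n → (n C j) * ((n ∸ j) C (s ∸ j)) ≡ (n C s) * (s C j)
nCj*[n∸j]C[s∸j]≡nCs*sCj {n} {s} {j} j≤s s≤n =
  *-cancelʳ-≡ _ _ (j ! * ((s ∸ j) ! * (n ∸ s) !)) {{factorials≢0}} (trans (via-j) (sym via-s))
  where
  open ≡-Reasoning
  factorials≢0 = m*n≢0 (j !) ((s ∸ j) ! * (n ∸ s) !) {{j !≢0}} {{(s ∸ j) !* (n ∸ s) !≢0}}
  n∸j∸[s∸j]≡n∸s : n ∸ j ∸ (s ∸ j) ≡ n ∸ s
  n∸j∸[s∸j]≡n∸s = trans (∸-+-assoc n j (s ∸ j)) (cong (n ∸_) (m+[n∸m]≡n j≤s))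
  via-j : (n C j) * ((n ∸ j) C (s ∸ j)) * (j ! * ((s ∸ j) ! * (n ∸ s) !)) ≡ n !
  via-j = begin
    (n C j) * ((n ∸ j) C (s ∸ j)) * (j ! * ((s ∸ j) ! * (n ∸ s) !))
      ≡⟨ regroup (n C j) ((n ∸ j) C (s ∸ j)) (j !) ((s ∸ j) !) ((n ∸ s) !) ⟩
    (n C j) * j ! * (((n ∸ j) C (s ∸ j)) * ((s ∸ j) ! * (n ∸ s) !))
      ≡⟨ cong (λ m → (n C j) * j ! * (((n ∸ j) C (s ∸ j)) * ((s ∸ j) ! * m !))) (sym n∸j∸[s∸j]≡n∸s) ⟩
    (n C j) * j ! * (((n ∸ j) C (s ∸ j)) * ((s ∸ j) ! * (n ∸ j ∸ (s ∸ j)) !))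
      ≡⟨ cong ((n C j) * j ! *_) (nCk*k![n∸k]!≡n! (∸-monoˡ-≤ j s≤n)) ⟩
    (n C j) * j ! * (n ∸ j) !
      ≡⟨ *-assoc (n C j) (j !) ((n ∸ j) !) ⟩
    (n C j) * (j ! * (n ∸ j) !)
      ≡⟨ nCk*k![n∸k]!≡n! (≤-trans j≤s s≤n) ⟩
    n ! ∎
    where
    regroup : ∀ a b c d e → a * b * (c * (d * e)) ≡ (a * c) * (b * (d * e))
    regroup = solve-∀
  via-s : (n C s) * (s C j) * (j ! * ((s ∸ j) ! * (n ∸ s) !)) ≡ n !
  via-s = begin
    (n C s) * (s C j) * (j ! * ((s ∸ j) ! * (n ∸ s) !))
      ≡⟨ regroup (n C s) (s C j) (j !) ((s ∸ j) !) ((n ∸ s) !) ⟩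
    (n C s) * ((s C j) * (j ! * (s ∸ j) !) * (n ∸ s) !)
      ≡⟨ cong (λ m → (n C s) * (m * (n ∸ s) !)) (nCk*k![n∸k]!≡n! j≤s) ⟩
    (n C s) * (s ! * (n ∸ s) !)
      ≡⟨ nCk*k![n∸k]!≡n! s≤n ⟩
    n ! ∎
    where
    regroup : ∀ a b c d e → a * b * (c * (d * e)) ≡ a * ((b * (c * d)) * e)
    regroup = solve-∀

restChoices-≤ : ∀ b {s j} → j ≤ s → restChoices b s j ≡ b C (s ∸ j)
restChoices-≤ b {s}     {zero}  _         = refl
restChoices-≤ b {suc s} {suc j} (s≤s j≤s) = restChoices-≤ b j≤s

restChoices-> : ∀ b {s j} → s < j → restChoices b s j ≡ 0
restChoices-> b {zero}  {suc j} _         = refl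
restChoices-> b {suc s} {suc j} (s≤s s<j) = restChoices-> b s<j

^-distribʳ-* : ∀ m n k → (m * n) ^ k ≡ m ^ k * n ^ k
^-distribʳ-* m n zero    = refl
^-distribʳ-* m n (suc k) = trans (cong (m * n *_) (^-distribʳ-* m n k)) (regroup m n (m ^ k) (n ^ k))
  where
  regroup : ∀ a b c d → a * b * (c * d) ≡ a * c * (b * d)
  regroup = solve-∀

-- Term by term, C(n,j) C(b,s-j) x^(s-j) ≤ C(n,j) C(n-j,s-j) = C(n,s) C(s,j), and the C(s,j) sum to at most 2^s.
kwBound*x^≤C*2^ : ∀ b t .{{_ : NonZero t}} n s x → 1 ≤ x → s ≤ n → 2 * (x * b) ≤ n → 2 * (n / t) ≤ s →
                  kwBound b t n s * x ^ (s ∸ n / t) ≤ (n C s) * 2 ^ s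
kwBound*x^≤C*2^ b t n s x 1≤x s≤n 2xb≤n 2K≤s = begin
  kwBound b t n s * X                                  ≡⟨ *-distribʳ-sum {suc K} X (λ j → (n C toℕ j) * R (toℕ j)) ⟩
  ∑[ j < suc K ] ((n C toℕ j) * R (toℕ j) * X)         ≤⟨ ∑-mono-≤ {suc K} (λ j → term (toℕ j) (s≤s⁻¹ (toℕ<n j))) ⟩
  ∑[ j < suc K ] ((n C s) * (s C toℕ j))               ≡⟨ sym (*-distribˡ-sum {suc K} (n C s) (λ j → s C toℕ j)) ⟩
  (n C s) * ∑[ j < suc K ] (s C toℕ j)                 ≤⟨ *-monoʳ-≤ (n C s) (∑-binomial≤2^ s (suc K)) ⟩
  (n C s) * 2 ^ s                                      ∎
  where
  open ≤-Reasoning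
  K = n / t
  R = restChoices b s
  X = x ^ (s ∸ K)
  instance
    x≢0 : NonZero x
    x≢0 = ℕ.>-nonZero 1≤x
  term : ∀ j → j ≤ K → (n C j) * R j * X ≤ (n C s) * (s C j)
  term j j≤K with j ℕ.≤? s
  ... | no j≰s rewrite restChoices-> b (≰⇒> j≰s) | *-zeroʳ (n C j) = z≤n
  ... | yes j≤s rewrite restChoices-≤ b j≤s = begin
    (n C j) * (b C (s ∸ j)) * x ^ (s ∸ K)      ≤⟨ *-monoʳ-≤ ((n C j) * (b C (s ∸ j))) (^-monoʳ-≤ x (∸-monoʳ-≤ s j≤K)) ⟩
    (n C j) * (b C (s ∸ j)) * x ^ (s ∸ j)      ≡⟨ *-assoc (n C j) (b C (s ∸ j)) (x ^ (s ∸ j)) ⟩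
    (n C j) * ((b C (s ∸ j)) * x ^ (s ∸ j))    ≤⟨ *-monoʳ-≤ (n C j) (C-scale (s ∸ j) 1≤x xb≤n∸j) ⟩
    (n C j) * ((n ∸ j) C (s ∸ j))              ≡⟨ nCj*[n∸j]C[s∸j]≡nCs*sCj j≤s s≤n ⟩
    (n C s) * (s C j)                          ∎
    where
    xb≤n∸j : x * b ≤ n ∸ j
    xb≤n∸j = m+n≤o⇒m≤o∸n (x * b) (*-cancelˡ-≤ 2 (begin
      2 * (x * b + j)      ≡⟨ *-distribˡ-+ 2 (x * b) j ⟩
      2 * (x * b) + 2 * j  ≤⟨ +-mono-≤ 2xb≤n (≤-trans (*-monoʳ-≤ 2 j≤K) (≤-trans 2K≤s s≤n)) ⟩
      n + n                ≡⟨ cong (n +_) (sym (+-identityʳ n)) ⟩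
      2 * n                ∎))

kwBound*q^≤C : ∀ b t .{{_ : NonZero t}} n s q → 1 ≤ q → s ≤ n → 8 * q * q * b ≤ n → 2 * (n / t) ≤ s →
               kwBound b t n s * q ^ s ≤ n C s
kwBound*q^≤C b t n s q 1≤q s≤n 8qqb≤n 2K≤s = *-cancelʳ-≤ _ _ (2 ^ s) {{m^n≢0 2 s}} (begin
  kwBound b t n s * q ^ s * 2 ^ s     ≡⟨ trans (*-assoc (kwBound b t n s) (q ^ s) (2 ^ s))
                                               (cong (kwBound b t n s *_) (trans (*-comm (q ^ s) (2 ^ s))
                                                                                (sym (^-distribʳ-* 2 q s)))) ⟩
  kwBound b t n s * (2 * q) ^ s       ≤⟨ *-monoʳ-≤ (kwBound b t n s) 2q^s≤x^[s∸K] ⟩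
  kwBound b t n s * x ^ (s ∸ K)       ≤⟨ kwBound*x^≤C*2^ b t n s x 1≤x s≤n (≤-trans (≤-reflexive (eight q b)) 8qqb≤n) 2K≤s ⟩
  (n C s) * 2 ^ s                     ∎)
  where
  open ≤-Reasoning
  K = n / t
  x = 4 * q * q
  1≤x : 1 ≤ x
  1≤x = *-mono-≤ (*-mono-≤ {1} {4} (s≤s z≤n) 1≤q) 1≤q
  eight : ∀ q b → 2 * (4 * q * q * b) ≡ 8 * q * q * b
  eight = solve-∀
  square : ∀ q → 2 * q * (2 * q * 1) ≡ 4 * q * q
  square = solve-∀
  s≤2[s∸K] : s ≤ 2 * (s ∸ K)
  s≤2[s∸K] = begin
    s              ≤⟨ m+n≤o⇒m≤o∸n s (≤-trans (+-monoʳ-≤ s 2K≤s) (≤-reflexive (cong (s +_) (sym (+-identityʳ s))))) ⟩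
    2 * s ∸ 2 * K  ≡⟨ sym (*-distribˡ-∸ 2 s K) ⟩
    2 * (s ∸ K)    ∎
  2q^s≤x^[s∸K] : (2 * q) ^ s ≤ x ^ (s ∸ K)
  2q^s≤x^[s∸K] = ≤-trans (^-monoʳ-≤ (2 * q) {{ℕ.>-nonZero (*-mono-≤ {1} {2} (s≤s z≤n) 1≤q)}} s≤2[s∸K])
                          (≤-reflexive (trans (sym (^-*-assoc (2 * q) 2 (s ∸ K))) (cong (_^ (s ∸ K)) (square q))))

-- Dense graphs

eG-tabulate≤ : ∀ {n} (G : BipGraph n) A d → (∀ u → T (A u) → size (A ∩ closedNbhd G u) ≤ d) →
               eG G (tabulate A) (tabulate A) ≤ size A * d
eG-tabulate≤ {n} G A d deg≤d = begin
  eG G S S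
    ≡⟨ eG≡∑∑ G S S ⟩
  ∑[ u < n ] ∑[ v < n ] ind (lookup S u ∧ lookup S v ∧ G u v)
    ≡⟨ sum-cong-≗ {n} (λ u → sum-cong-≗ {n} (λ v →
         cong₂ (λ a b → ind (a ∧ b ∧ G u v)) (lookup∘tabulate A u) (lookup∘tabulate A v))) ⟩
  ∑[ u < n ] ∑[ v < n ] ind (A u ∧ A v ∧ G u v)
    ≤⟨ ∑-mono-≤ out-degree ⟩
  ∑[ u < n ] (ind (A u) * d)
    ≡⟨ sym (*-distribʳ-sum {n} d (ind ∘ A)) ⟩
  size A * d ∎
  where
  open ≤-Reasoning
  S = tabulate A
  out-degree : ∀ u → ∑[ v < n ] ind (A u ∧ A v ∧ G u v) ≤ ind (A u) * d
  out-degree u with A u in Au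
  ... | false = ≤-reflexive (∑-zero {n} λ _ → refl)
  ... | true  = begin
    size (λ v → A v ∧ G u v)       ≤⟨ size-mono (λ v h → from T-∧ (proj₁ (to (T-∧ {A v}) h) , from T-∨ (inj₂ (proj₂ (to (T-∧ {A v}) h))))) ⟩
    size (A ∩ closedNbhd G u)      ≤⟨ deg≤d u (subst T (sym Au) tt) ⟩
    d                              ≡⟨ sym (+-identityʳ d) ⟩
    1 * d                          ∎

∣tabulate∣≡size : ∀ {n} (A : Fin n → Bool) → ∣ tabulate A ∣ ≡ size A
∣tabulate∣≡size {n} A = trans (∣∣≡size-lookup (tabulate A)) (sum-cong-≗ {n} (cong ind ∘ lookup∘tabulate A))

-- If a set A with n ≤ m |A| had all closed out-degrees inside A at most t, then e(A,A) ≤ |A| t,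
-- and the density bound would force e(G) ≤ m p t n.
dense⇒largeSetsHaveDegree : ∀ {n} (G : BipGraph n) m p t .{{_ : NonZero m}} → 1 ≤ n → 1 ≤ p →
  (∀ (A : Subset n) → n ≤ m * ∣ A ∣ → ∣ A ∣ * ∣ A ∣ * eG G ⊤ ⊤ ≤ p * eG G A A * n * n) →
  suc t * (m * p * n) ≤ eG G ⊤ ⊤ → LargeSetsHaveDegree G (n / m) (suc t)
dense⇒largeSetsHaveDegree {n} G m p t 1≤n 1≤p dense many-edges A with n ℕ.≤? m * size A
... | no n≰m|A| = inj₁ (begin
  size A               ≡⟨ sym (m*n/n≡m (size A) m) ⟩
  size A * m / m       ≤⟨ /-monoˡ-≤ m (≤-trans (≤-reflexive (*-comm (size A) m)) (<⇒≤ (≰⇒> n≰m|A|))) ⟩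
  n / m                ∎)
  where open ≤-Reasoning
... | yes n≤m|A| with any? (λ u → T? (A u) ×-dec (suc t ℕ.≤? size (A ∩ closedNbhd G u)))
...   | yes high-degree = inj₂ high-degree
...   | no ∄high-degree = contradiction E≤mptn (<⇒≱ mptn<E)
  where
  open ≤-Reasoning
  a = size A
  E = eG G ⊤ ⊤
  1≤m : 1 ≤ m
  1≤m = ℕ.>-nonZero⁻¹ m
  1≤a : 1 ≤ a
  1≤a = ℕ.>-nonZero⁻¹ a {{m*n≢0⇒n≢0 m {{ℕ.>-nonZero (≤-trans 1≤n n≤m|A|)}}}}
  low-degree : ∀ u → T (A u) → size (A ∩ closedNbhd G u) ≤ t
  low-degree u Au with suc t ℕ.≤? size (A ∩ closedNbhd G u)
  ... | yes t<deg = contradiction (u , Au , t<deg) ∄high-degree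
  ... | no  t≮deg = s≤s⁻¹ (≰⇒> t≮deg)
  e≤at : eG G (tabulate A) (tabulate A) ≤ a * t
  e≤at = eG-tabulate≤ G A t low-degree
  aE≤ptnn : a * E ≤ p * t * n * n
  aE≤ptnn = *-cancelˡ-≤ a {{ℕ.>-nonZero 1≤a}} (begin
    a * (a * E)                                ≡⟨ sym (*-assoc a a E) ⟩
    a * a * E                                  ≡⟨ cong (λ x → x * x * E) (sym (∣tabulate∣≡size A)) ⟩
    ∣ tabulate A ∣ * ∣ tabulate A ∣ * E         ≤⟨ dense (tabulate A) (subst (λ x → n ≤ m * x) (sym (∣tabulate∣≡size A)) n≤m|A|) ⟩
    p * eG G (tabulate A) (tabulate A) * n * n ≤⟨ *-monoˡ-≤ n (*-monoˡ-≤ n (*-monoʳ-≤ p e≤at)) ⟩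
    p * (a * t) * n * n                        ≡⟨ regroup p a t n ⟩
    a * (p * t * n * n)                        ∎)
    where
    regroup : ∀ p a t n → p * (a * t) * n * n ≡ a * (p * t * n * n)
    regroup = solve-∀
  E≤mptn : E ≤ t * (m * p * n)
  E≤mptn = *-cancelˡ-≤ n {{ℕ.>-nonZero 1≤n}} (begin
    n * E              ≤⟨ *-monoˡ-≤ E n≤m|A| ⟩
    m * a * E          ≡⟨ *-assoc m a E ⟩
    m * (a * E)        ≤⟨ *-monoʳ-≤ m aE≤ptnn ⟩
    m * (p * t * n * n) ≡⟨ regroup m p t n ⟩
    n * (t * (m * p * n)) ∎)
    where
    regroup : ∀ m p t n → m * (p * t * n * n) ≡ n * (t * (m * p * n))
    regroup = solve-∀
  mptn<E : t * (m * p * n) < E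
  mptn<E = ≤-trans (+-monoˡ-≤ (t * (m * p * n)) (*-mono-≤ (*-mono-≤ 1≤m 1≤p) 1≤n)) many-edges

-- With d = m p n, the threshold t = E / d is at least 4, and 4 n d ≤ s E < s (t + 1) d ≤ 2 s t d.
degreeThreshold : ∀ n E m p s → 1 ≤ n → 1 ≤ m → 1 ≤ p → s ≤ n → 4 * m * p * n * n ≤ s * E →
                  Σ ℕ λ t → suc t * (m * p * n) ≤ E × 2 * (n / suc t) ≤ s
degreeThreshold n E m p s 1≤n 1≤m 1≤p s≤n many-edges = as-successor t t*d≤E 2[n/t]≤s
  where
  open ≤-Reasoning
  d = m * p * n
  instance
    d≢0 : NonZero d
    d≢0 = ℕ.>-nonZero (*-mono-≤ (*-mono-≤ 1≤m 1≤p) 1≤n)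
  n*4d≤s*E : n * (4 * d) ≤ s * E
  n*4d≤s*E = ≤-trans (≤-reflexive (regroup m p n)) many-edges
    where
    regroup : ∀ m p n → n * (4 * (m * p * n)) ≡ 4 * m * p * n * n
    regroup = solve-∀
  4d≤E : 4 * d ≤ E
  4d≤E = *-cancelˡ-≤ n {{ℕ.>-nonZero 1≤n}} (≤-trans n*4d≤s*E (*-monoˡ-≤ E s≤n))
  t = E / d
  1≤t : 1 ≤ t
  1≤t = m≥n⇒m/n>0 (≤-trans (m≤n*m d 4) 4d≤E)
  instance
    t≢0 : NonZero t
    t≢0 = ℕ.>-nonZero 1≤t
  t*d≤E : t * d ≤ E
  t*d≤E = m/n*n≤m E d
  E≤[1+t]*d : E ≤ suc t * d
  E≤[1+t]*d = ≤-trans (≤-reflexive (m≡m%n+[m/n]*n E d)) (+-monoˡ-≤ (t * d) (<⇒≤ (m%n<n E d)))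
  2n≤s*t : 2 * n ≤ s * t
  2n≤s*t = *-cancelˡ-≤ 2 (*-cancelʳ-≤ (2 * (2 * n)) (2 * (s * t)) d (begin
    2 * (2 * n) * d   ≡⟨ regroup n d ⟩
    n * (4 * d)       ≤⟨ n*4d≤s*E ⟩
    s * E             ≤⟨ *-monoʳ-≤ s E≤[1+t]*d ⟩
    s * (suc t * d)   ≤⟨ *-monoʳ-≤ s (*-monoˡ-≤ d (+-monoˡ-≤ t 1≤t)) ⟩
    s * ((t + t) * d) ≡⟨ regroup′ s t d ⟩
    2 * (s * t) * d   ∎))
    where
    regroup : ∀ n d → 2 * (2 * n) * d ≡ n * (4 * d)
    regroup = solve-∀
    regroup′ : ∀ s t d → s * ((t + t) * d) ≡ 2 * (s * t) * d
    regroup′ = solve-∀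
  2[n/t]≤s : 2 * (n / t) ≤ s
  2[n/t]≤s = *-cancelʳ-≤ (2 * (n / t)) s t (begin
    2 * (n / t) * t   ≡⟨ *-assoc 2 (n / t) t ⟩
    2 * (n / t * t)   ≤⟨ *-monoʳ-≤ 2 (m/n*n≤m n t) ⟩
    2 * n             ≤⟨ 2n≤s*t ⟩
    s * t             ∎)
  as-successor : ∀ t .{{_ : NonZero t}} → t * d ≤ E → 2 * (n / t) ≤ s →
                 Σ ℕ λ t′ → suc t′ * d ≤ E × 2 * (n / suc t′) ≤ s
  as-successor (suc t′) t*d≤E 2[n/t]≤s = t′ , t*d≤E , 2[n/t]≤s

size-full : ∀ n → size {n} (λ _ → true) ≡ n
size-full zero    = refl
size-full (suc n) = cong suc (size-full n)

countEmpty≤independentSubsets : ∀ {n} (G : BipGraph n) s → countEmpty G s ≤ independentSubsets G (λ _ → true) s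
countEmpty≤independentSubsets {n} G s =
  ≤-trans (≤-reflexive (length-filter-allSubsets n P))
          (countSubsets-mono {n} {P} λ S h → from T-∧ (⊆⇒⊆ᵇ S _ (λ _ _ → tt) , h))
  where
  P = λ S → hasSize s S ∧ isEmptyInduced G S

countEmpty*q^s≤C : ∀ {n} (G : BipGraph n) q p s → 1 ≤ n → 1 ≤ q → 1 ≤ p →
  (∀ (A : Subset n) → n ≤ 8 * q * q * ∣ A ∣ → ∣ A ∣ * ∣ A ∣ * eG G ⊤ ⊤ ≤ p * eG G A A * n * n) →
  s ≤ n → 4 * (8 * q * q) * p * n * n ≤ s * eG G ⊤ ⊤ → countEmpty G s * q ^ s ≤ n C s
countEmpty*q^s≤C {n} G q p s 1≤n 1≤q 1≤p dense s≤n many-edges =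
  bound (degreeThreshold n (eG G ⊤ ⊤) m p s 1≤n 1≤m 1≤p s≤n many-edges)
  where
  open ≤-Reasoning
  m = 8 * q * q
  1≤m : 1 ≤ m
  1≤m = *-mono-≤ (*-mono-≤ {1} {8} (s≤s z≤n) 1≤q) 1≤q
  instance
    m≢0 : NonZero m
    m≢0 = ℕ.>-nonZero 1≤m
  bound : Σ ℕ (λ t → suc t * (m * p * n) ≤ eG G ⊤ ⊤ × 2 * (n / suc t) ≤ s) → countEmpty G s * q ^ s ≤ n C s
  bound (t , t*mpn≤E , 2[n/t]≤s) = begin
    countEmpty G s * q ^ s
      ≤⟨ *-monoˡ-≤ (q ^ s) (≤-trans (countEmpty≤independentSubsets G s)
           (containerBound G (n / m) (suc t) (dense⇒largeSetsHaveDegree G m p t 1≤n 1≤p dense t*mpn≤E)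
                           n (λ _ → true) s (≤-reflexive (size-full n)))) ⟩
    kwBound (n / m) (suc t) n s * q ^ s
      ≤⟨ kwBound*q^≤C (n / m) (suc t) n s q 1≤q s≤n (≤-trans (≤-reflexive (*-comm m (n / m))) (m/n*n≤m n m)) 2[n/t]≤s ⟩
    n C s ∎

infixl 7 _÷_

_÷_ : ℕ → (d : ℕ) → .{{NonZero d}} → ℚ
a ÷ d = ℤ.+ a ℚ./ d

toℚᵘ-÷ : ∀ a b .{{_ : NonZero b}} → toℚᵘ (a ÷ b) ℚᵘ.≃ ℚᵘ.mkℚᵘ (ℤ.+ a) (ℕ.pred b)
toℚᵘ-÷ a (suc b) = ℚ.toℚᵘ-fromℚᵘ (ℚᵘ.mkℚᵘ (ℤ.+ a) b)

*≤*⇒÷≤÷ : ∀ a b c d .{{_ : NonZero b}} .{{_ : NonZero d}} → a * d ≤ c * b → a ÷ b ℚ.≤ c ÷ d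
*≤*⇒÷≤÷ a b@(suc _) c d@(suc _) ad≤cb =
  ℚ.toℚᵘ-cancel-≤ (ℚᵘ.≤-respʳ-≃ (ℚᵘ.≃-sym (toℚᵘ-÷ c d)) (ℚᵘ.≤-respˡ-≃ (ℚᵘ.≃-sym (toℚᵘ-÷ a b))
    (ℚᵘ.*≤* (subst₂ ℤ._≤_ (ℤ.pos-* a d) (ℤ.pos-* c b) (+≤+ ad≤cb)))))

÷≤÷⇒*≤* : ∀ a b c d .{{_ : NonZero b}} .{{_ : NonZero d}} → a ÷ b ℚ.≤ c ÷ d → a * d ≤ c * b
÷≤÷⇒*≤* a b@(suc _) c d@(suc _) a/b≤c/d
  with ℚᵘ.≤-respʳ-≃ (toℚᵘ-÷ c d) (ℚᵘ.≤-respˡ-≃ (toℚᵘ-÷ a b) (ℚ.toℚᵘ-mono-≤ a/b≤c/d))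
... | ℚᵘ.*≤* ad≤cb = ℤ.drop‿+≤+ (subst₂ ℤ._≤_ (sym (ℤ.pos-* a d)) (sym (ℤ.pos-* c b)) ad≤cb)

÷-*-÷ : ∀ a b c d .{{_ : NonZero b}} .{{_ : NonZero d}} →
             (a ÷ b) ℚ.* (c ÷ d) ≡ ((a * c) ÷ (b * d)) {{m*n≢0 b d}}
÷-*-÷ a b@(suc _) c d@(suc _) = ℚ.toℚᵘ-injective (begin
  toℚᵘ ((a ÷ b) ℚ.* (c ÷ d))                          ≈⟨ ℚ.toℚᵘ-homo-* (a ÷ b) (c ÷ d) ⟩
  toℚᵘ (a ÷ b) ℚᵘ.* toℚᵘ (c ÷ d)                       ≈⟨ ℚᵘ.*-cong (toℚᵘ-÷ a b) (toℚᵘ-÷ c d) ⟩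
  ℚᵘ.mkℚᵘ (ℤ.+ a) (ℕ.pred b) ℚᵘ.* ℚᵘ.mkℚᵘ (ℤ.+ c) (ℕ.pred d)    ≈⟨ ℚᵘ.*≡* (cong (ℤ._* ℤ.+ (b * d)) (sym (ℤ.pos-* a c))) ⟩
  ℚᵘ.mkℚᵘ (ℤ.+ (a * c)) (ℕ.pred (b * d))                       ≈⟨ ℚᵘ.≃-sym (toℚᵘ-÷ (a * c) (b * d)) ⟩
  toℚᵘ ((a * c) ÷ (b * d))                               ∎)
  where open import Relation.Binary.Reasoning.Setoid ℚᵘ.≃-setoid

÷-^ : ∀ a d .{{_ : NonZero d}} s → (a ÷ d) ^ℚ s ≡ ((a ^ s) ÷ (d ^ s)) {{m^n≢0 d s}}
÷-^ a d zero    = refl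
÷-^ a d (suc s) = trans (cong ((a ÷ d) ℚ.*_) (÷-^ a d s)) (÷-*-÷ a d (a ^ s) (d ^ s) {{it}} {{m^n≢0 d s}})

÷-pos : ∀ a d .{{_ : NonZero a}} .{{_ : NonZero d}} → 0ℚ ℚ.< a ÷ d
÷-pos a d = ℚ.positive⁻¹ (a ÷ d) {{ℚ.normalize-pos a d}}

positive⇒÷ : ∀ {q} → 0ℚ ℚ.< q → Σ ℕ λ k → Σ ℕ λ d → q ≡ suc k ÷ suc d
positive⇒÷ {mkℚ +[1+ k ] d coprime} _   = k , d , sym (ℚ.normalize-coprime coprime)
positive⇒÷ {mkℚ (ℤ.+ 0)    _ _}       0<q = ⊥-elim (ℤ.Positive.pos (ℚ.positive 0<q))
positive⇒÷ {mkℚ -[1+ _ ] _ _}       0<q = ⊥-elim (ℤ.Positive.pos (ℚ.positive 0<q))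

probEmpty≤÷ : ∀ {n} (G : BipGraph n) s a d .{{_ : NonZero d}} → countEmpty G s * d ≤ a * (n C s) →
              probEmpty G s ℚ.≤ a ÷ d
probEmpty≤÷ {n} G s a d count≤ with n C s
... | zero  = *≤*⇒÷≤÷ 0 1 a d z≤n
... | suc k = *≤*⇒÷≤÷ (countEmpty G s) (suc k) a d count≤

density-cleared : ∀ {n} (G : BipGraph (suc n)) m {c} k p .{{_ : NonZero m}} .{{_ : NonZero p}} → c ≡ suc k ÷ p →
  (∀ (A : Subset (suc n)) → (1 ÷ m) ℚ.* ℕ→ℚ (suc n) ℚ.≤ ℕ→ℚ ∣ A ∣ →
     c ℚ.* ℕ→ℚ (∣ A ∣ * ∣ A ∣) ℚ.* avgDeg G ℚ.≤ ℕ→ℚ (eG G A A) ℚ.* ℕ→ℚ (suc n)) →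
  ∀ (A : Subset (suc n)) → suc n ≤ m * ∣ A ∣ → ∣ A ∣ * ∣ A ∣ * eG G ⊤ ⊤ ≤ p * eG G A A * suc n * suc n
density-cleared {n} G m@(suc _) k p@(suc _) refl dense A N≤ma = begin
  a * a * E                      ≤⟨ m≤n*m (a * a * E) (suc k) ⟩
  suc k * (a * a * E)            ≡⟨ regroup (suc k) a E ⟩
  suc k * (a * a) * E * (1 * 1)  ≤⟨ ÷≤÷⇒*≤* (suc k * (a * a) * E) (p * 1 * N) (e * N) (1 * 1) cleared ⟩
  e * N * (p * 1 * N)            ≡⟨ regroup′ e N p ⟩
  p * e * N * N                  ∎
  where
  open ≤-Reasoning
  N = suc n
  a = ∣ A ∣
  E = eG G ⊤ ⊤
  e = eG G A A
  εN≤a : (1 ÷ m) ℚ.* ℕ→ℚ N ℚ.≤ ℕ→ℚ a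
  εN≤a = subst (ℚ._≤ ℕ→ℚ a) (sym (÷-*-÷ 1 m N 1))
           (*≤*⇒÷≤÷ (1 * N) (m * 1) a 1 (subst₂ _≤_ (unit N) (swap m a) N≤ma))
    where
    unit : ∀ N → N ≡ 1 * N * 1
    unit = solve-∀
    swap : ∀ m a → m * a ≡ a * (m * 1)
    swap = solve-∀
  cleared : (suc k * (a * a) * E) ÷ (p * 1 * N) ℚ.≤ (e * N) ÷ (1 * 1)
  cleared = subst₂ ℚ._≤_ (trans (cong (ℚ._* avgDeg G) (÷-*-÷ (suc k) p (a * a) 1)) (÷-*-÷ (suc k * (a * a)) (p * 1) E N))
                         (÷-*-÷ e 1 N 1)
                         (dense A εN≤a)
  regroup : ∀ k a E → k * (a * a * E) ≡ k * (a * a) * E * (1 * 1)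
  regroup = solve-∀
  regroup′ : ∀ e N p → e * N * (p * 1 * N) ≡ p * e * N * N
  regroup′ = solve-∀

edges-cleared : ∀ {n} (G : BipGraph (suc n)) c s →
  (c ÷ 1) ℚ.* ℕ→ℚ (suc n) ℚ.≤ ℕ→ℚ s ℚ.* avgDeg G → c * suc n * suc n ≤ s * eG G ⊤ ⊤
edges-cleared {n} G c s cN≤sd = begin
  c * N * N            ≡⟨ regroup c N ⟩
  c * N * (1 * N)      ≤⟨ ÷≤÷⇒*≤* (c * N) (1 * 1) (s * E) (1 * N)
                            (subst₂ ℚ._≤_ (÷-*-÷ c 1 N 1) (÷-*-÷ s 1 E N) cN≤sd) ⟩
  s * E * (1 * 1)      ≡⟨ regroup′ s E ⟩
  s * E                ∎
  where
  open ≤-Reasoning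
  N = suc n
  E = eG G ⊤ ⊤
  regroup : ∀ c N → c * N * N ≡ c * N * (1 * N)
  regroup = solve-∀
  regroup′ : ∀ s E → s * E * (1 * 1) ≡ s * E
  regroup′ = solve-∀

probEmpty≤α^s : ∀ (G : (n : ℕ) → BipGraph n) {α c} k q-1 kc p-1 nε → α ≡ suc k ÷ suc q-1 → c ≡ suc kc ÷ suc p-1 →
  ((n : ℕ) → nε ≤ n → (A : Subset n) → (1 ÷ (8 * suc q-1 * suc q-1)) ℚ.* ℕ→ℚ n ℚ.≤ ℕ→ℚ ∣ A ∣ →
     c ℚ.* ℕ→ℚ (∣ A ∣ * ∣ A ∣) ℚ.* avgDeg (G n) ℚ.≤ ℕ→ℚ (eG (G n) A A) ℚ.* ℕ→ℚ n) →
  (n : ℕ) → suc nε ≤ n → (s : ℕ) → ((4 * (8 * suc q-1 * suc q-1) * suc p-1) ÷ 1) ℚ.* ℕ→ℚ n ℚ.≤ ℕ→ℚ s ℚ.* avgDeg (G n) →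
  s ≤ n → probEmpty (G n) s ℚ.≤ α ^ℚ s
probEmpty≤α^s G k q-1 kc p-1 nε refl c≡ dense (suc n) (s≤s nε≤n) s κN≤sd s≤n =
  subst (probEmpty (G N) s ℚ.≤_) (sym (÷-^ (suc k) q s)) (probEmpty≤÷ (G N) s (suc k ^ s) (q ^ s) {{m^n≢0 q s}} (begin
    countEmpty (G N) s * q ^ s
      ≤⟨ countEmpty*q^s≤C (G N) q p s (s≤s z≤n) (s≤s z≤n) (s≤s z≤n)
           (density-cleared (G N) m kc p c≡ (dense N (m≤n⇒m≤1+n nε≤n))) s≤n (edges-cleared (G N) κ s κN≤sd) ⟩
    N C s
      ≤⟨ m≤n*m (N C s) (suc k ^ s) {{m^n≢0 (suc k) s}} ⟩
    suc k ^ s * (N C s) ∎))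
  where
  open ≤-Reasoning
  N = suc n
  q = suc q-1
  p = suc p-1
  m = 8 * q * q
  κ = 4 * m * p

lemma2p1 : (G : (n : ℕ) → BipGraph n) →
             ((ε : ℚ) → 0ℚ ℚ.< ε →
               Σ ℕ (λ nε → Σ ℚ (λ c → 0ℚ ℚ.< c ×
                 ((n : ℕ) → nε ≤ n → (A : Subset n) → ε ℚ.* ℕ→ℚ n ℚ.≤ ℕ→ℚ ∣ A ∣ →
                   c ℚ.* ℕ→ℚ (∣ A ∣ * ∣ A ∣) ℚ.* avgDeg (G n) ℚ.≤ ℕ→ℚ (eG (G n) A A) ℚ.* ℕ→ℚ n)))) →
             (α : ℚ) → 0ℚ ℚ.< α →
             Σ ℕ (λ nα → Σ ℚ (λ C → 0ℚ ℚ.< C ×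
               ((n : ℕ) → nα ≤ n → (s : ℕ) → C ℚ.* ℕ→ℚ n ℚ.≤ ℕ→ℚ s ℚ.* avgDeg (G n) → s ≤ n →
                 probEmpty (G n) s ℚ.≤ α ^ℚ s)))
lemma2p1 G dense α 0<α =
  case positive⇒÷ 0<α of λ (k , q-1 , α≡) →
  case dense (1 ÷ (8 * suc q-1 * suc q-1)) (÷-pos 1 (8 * suc q-1 * suc q-1)) of λ (nε , c , 0<c , c-dense) →
  case positive⇒÷ 0<c of λ (kc , p-1 , c≡) →
  suc nε , (4 * (8 * suc q-1 * suc q-1) * suc p-1) ÷ 1 , ÷-pos (4 * (8 * suc q-1 * suc q-1) * suc p-1) 1 ,
  probEmpty≤α^s G k q-1 kc p-1 nε α≡ c≡ c-dense
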